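{- Fix $b\in\{0,1\}^{\mathbb{N}}$ and a positive integer $N$. Let $f_1,f_2:\mathbb{N}^{\mathbb{N}}\to\mathbb{N}$ be defined by: $f_1(\alpha):=$ the least $n<N$ such that $\neg(\alpha_{n-1}<\alpha_n)\vee b_{\alpha_n}=1$ (first disjunct omitted for $n=0$), or $N-1$ if no such $n$ exists; and, with $n:=f_1(\alpha)$, $f_2(\alpha):=$ the least $y$ with $\alpha_n\le y\le\alpha_n+N-1$ and $b_y=0$ if $b_{\alpha_n}=1$ and such $y$ exists, and $\alpha_n+N-1$ otherwise. Let $\mathcal{A}_\omega$ be the two-oracle algorithm described in the context, run with oracles $\phi_1:=f_1$, $\phi_2:=f_2$. Then there is a run from the initial state $\langle[(\mathsf{s},0)],[\,]\mid\Box,\Box\rangle$ to an end state $\langle[\,],a\mid n,y\rangle$, and for $\alpha:=a::\mathbf{0}$: if $b_{\alpha_n}=1$ then $b_{\alpha_n}=b_{\alpha_n+1}=\dots=b_{\alpha_n+N-1}$; and if $b_{\alpha_n}=0$ then $\alpha_0<\alpha_1<\dots<\alpha_{N-1}$ and $b_{\alpha_0}=\dots=b_{\alpha_{N-1}}$.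
   Context: $\mathbb{N}^\ast$ (and $Z^\ast$) denotes finite sequences, $[\,]$ the empty sequence, $|\sigma|$ the length, $::$ extension/concatenation, $\mathbf{0}$ the constant zero sequence. $\Box$ is a fresh symbol. The algorithm $\mathcal{A}_\omega$: states are $\langle\sigma,a\mid o_1,o_2\rangle$ with $\sigma\in(\{\mathsf{s},\mathsf{e}_1,\mathsf{e}_2\}\times\mathbb{N})^\ast$, $a\in\mathbb{N}^\ast$, $o_1,o_2\in\mathbb{N}\cup\{\Box\}$; initial state $\langle[(\mathsf{s},0)],[\,]\mid\Box,\Box\rangle$; $Q_1$: states $\langle\sigma::(c,x),[\,]\mid\Box,\Box\rangle$ with $c\in\{\mathsf{s},\mathsf{e}_1\}$; $Q_2$: states $\langle\sigma,[\,]\mid n,\Box\rangle$ with $n<|\sigma|$; end states: $\langle[\,],a\mid n,y\rangle$ with $n,y\in\mathbb{N}$; $\xi_\omega(\sigma,a):=\sigma_2::a::\mathbf{0}$ where $\sigma_2$ is the sequence of second components of $\sigma$. Transitions: (a) $\langle\sigma::(c,x),[\,]\mid n,\Box\rangle\rhd_\omega\langle\sigma::(c,x)::(\mathsf{s},x+1),[\,]\mid\Box,\Box\rangle$; (b) $\langle\sigma::(\mathsf{e}_i,x),a\mid n,y\rangle\rhd_\omega\langle\sigma,x::a\mid n,y\rangle$; (c) $\langle\sigma::(\mathsf{s},x),a\mid n,y\rangle\rhd_\omega\langle\sigma::(\mathsf{e}_1,y),[\,]\mid\Box,\Box\rangle$ if $b_x=1\wedge x\le y\wedge b_y=0$, otherwise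 $\rhd_\omega\langle\sigma::(\mathsf{e}_2,x),a\mid n,y\rangle$. With oracles $\phi_1,\phi_2:\mathbb{N}^{\mathbb{N}}\to\mathbb{N}$: a state $\langle\sigma,a\mid\Box,\Box\rangle\in Q_1$ moves to $\langle\sigma,a\mid\phi_1(\xi_\omega(\sigma,a)),\Box\rangle$; a state $\langle\sigma,a\mid n,\Box\rangle\in Q_2$ moves to $\langle\sigma,a\mid n,\phi_2(\xi_\omega(\sigma,a))\rangle$; all other states move by $\rhd_\omega$. A run is a finite sequence of such moves in which no state before the last is an end state. -}

module Defs where

open import Data.Nat using (ℕ; zero; suc; _+_; _∸_; _≤_; _<_; _<ᵇ_)
open import Data.Bool using (Bool; true; false; not; _∨_; if_then_else_)
open import Data.List using (List; []; _∷_; _∷ʳ_; _++_; map; length)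
open import Data.Maybe using (Maybe; just; nothing; fromMaybe)
open import Data.Product using (_×_; _,_; proj₂)
open import Relation.Nullary using (¬_)
open import Relation.Binary.PropositionalEquality using (_≡_)

-- a finite sequence followed by the constant zero sequence: a :: 0
ext : List ℕ → ℕ → ℕ
ext []      _       = 0
ext (x ∷ _) zero    = x
ext (_ ∷ a) (suc i) = ext a i

find : (ℕ → Bool) → ℕ → ℕ → Maybe ℕ
find p s zero    = nothing
find p s (suc k) = if p s then just s else find p (suc s) k

cond₁ : (ℕ → Bool) → (ℕ → ℕ) → ℕ → Bool
cond₁ b α zero    = b (α zero)
cond₁ b α (suc n) = not (α n <ᵇ α (suc n)) ∨ b (α (suc n))

f₁ : (ℕ → Bool) → ℕ → (ℕ → ℕ) → ℕ
f₁ b N α = fromMaybe (N ∸ 1) (find (cond₁ b α) 0 N)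

f₂ : (ℕ → Bool) → ℕ → (ℕ → ℕ) → ℕ
f₂ b N α =
  let m = α (f₁ b N α) in
  if b m then fromMaybe (m + (N ∸ 1)) (find (λ y → not (b y)) m N)
         else m + (N ∸ 1)

data Tag : Set where
  s e₁ e₂ : Tag

record State : Set where
  constructor ⟨_,_∣_,_⟩
  field
    σ  : List (Tag × ℕ)
    a  : List ℕ
    o₁ : Maybe ℕ     -- nothing = □
    o₂ : Maybe ℕ     -- nothing = □

ξ : List (Tag × ℕ) → List ℕ → ℕ → ℕ
ξ σ a = ext (map proj₂ σ ++ a)

initial : State
initial = ⟨ (s , 0) ∷ [] , [] ∣ nothing , nothing ⟩

IsEnd : State → Set
IsEnd ⟨ [] , _ ∣ just _ , just _ ⟩ = Data.Unit.⊤
  where import Data.Unit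
IsEnd _ = Data.Empty.⊥
  where import Data.Empty

module Algo (b : ℕ → Bool) (φ₁ φ₂ : (ℕ → ℕ) → ℕ) where

  data Move : State → State → Set where
    -- oracle move from Q₁ (last tag s or e₁, a = [], both outputs □)
    q₁-s  : ∀ σ x → Move ⟨ σ ∷ʳ (s , x) , [] ∣ nothing , nothing ⟩
                         ⟨ σ ∷ʳ (s , x) , [] ∣ just (φ₁ (ξ (σ ∷ʳ (s , x)) [])) , nothing ⟩
    q₁-e₁ : ∀ σ x → Move ⟨ σ ∷ʳ (e₁ , x) , [] ∣ nothing , nothing ⟩
                         ⟨ σ ∷ʳ (e₁ , x) , [] ∣ just (φ₁ (ξ (σ ∷ʳ (e₁ , x)) [])) , nothing ⟩
    -- oracle move from Q₂ (a = [], o₁ = n < |σ|, o₂ = □)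
    q₂    : ∀ σ n → n < length σ →
            Move ⟨ σ , [] ∣ just n , nothing ⟩ ⟨ σ , [] ∣ just n , just (φ₂ (ξ σ [])) ⟩
    -- (a), only for states not in Q₂, i.e. n ≥ |σ :: (c,x)|
    ▹a    : ∀ σ c x n → length (σ ∷ʳ (c , x)) ≤ n →
            Move ⟨ σ ∷ʳ (c , x) , [] ∣ just n , nothing ⟩
                 ⟨ σ ∷ʳ (c , x) ∷ʳ (s , suc x) , [] ∣ nothing , nothing ⟩
    ▹b₁   : ∀ σ x a n y → Move ⟨ σ ∷ʳ (e₁ , x) , a ∣ just n , just y ⟩ ⟨ σ , x ∷ a ∣ just n , just y ⟩
    ▹b₂   : ∀ σ x a n y → Move ⟨ σ ∷ʳ (e₂ , x) , a ∣ just n , just y ⟩ ⟨ σ , x ∷ a ∣ just n , just y ⟩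
    ▹c₁   : ∀ σ x a n y → b x ≡ true × x ≤ y × b y ≡ false →
            Move ⟨ σ ∷ʳ (s , x) , a ∣ just n , just y ⟩ ⟨ σ ∷ʳ (e₁ , y) , [] ∣ nothing , nothing ⟩
    ▹c₂   : ∀ σ x a n y → ¬ (b x ≡ true × x ≤ y × b y ≡ false) →
            Move ⟨ σ ∷ʳ (s , x) , a ∣ just n , just y ⟩ ⟨ σ ∷ʳ (e₂ , x) , a ∣ just n , just y ⟩

  data Run : State → State → Set where
    done : ∀ {t} → Run t t
    step : ∀ {r r' t} → ¬ IsEnd r → Move r r' → Run r' t → Run r t

module Submission where

-- Along the run the stack σ keeps the values v₀ < v₁ < … < v_k
-- with b(v_i) = 0 for i < k; its top is tagged s, or e₁ after a jump (c)
-- has replaced v_k by some larger y with b(y) = 0.  For such a rising list,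
-- f₁ points at the top of the stack, or one past it when b(v_k) = 0 and
-- there is room (< N entries).  Hence each round either pushes v_k + 1
-- (move (a)), jumps to the first zero of b above v_k (move (c)), or – when
-- the stack is full or no zero exists in the window – gets an answer y
-- against which no entry can jump, so the stack unwinds by moves (b), (c).

open import Defs
open import Data.Nat using (ℕ; zero; suc; _+_; _∸_; _≤_; _<_; _<ᵇ_; z≤n; s≤s)
open import Data.Nat.Properties
open import Data.Bool.Properties using (not-injective)
open import Data.Bool using (Bool; true; false; not; if_then_else_)
open import Data.List using (List; []; _∷_; _∷ʳ_; _++_; map; length)
open import Data.List.Properties using (map-++; length-map; length-++; ++-identityʳ; ++-assoc)
open import Data.List.Reverse using (Reverse; []; _∶_∶ʳ_; reverseView)
open import Data.List.Relation.Unary.All as All using (All; []; _∷_)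
open import Data.List.Relation.Unary.All.Properties using (∷ʳ⁻; map⁻)
open import Data.Maybe using (just; nothing; fromMaybe)
open import Data.Product using (Σ; _×_; _,_; proj₁; proj₂)
open import Data.Sum using (_⊎_; inj₁; inj₂)
open import Relation.Nullary using (¬_; contradiction)
open import Relation.Binary.PropositionalEquality

length-∷ʳ : ∀ {A : Set} (xs : List A) x → length (xs ∷ʳ x) ≡ suc (length xs)
length-∷ʳ xs x = trans (length-++ xs) (+-comm (length xs) 1)

∷ʳ-position : ∀ {A : Set} (xs : List A) x {i} → i < length (xs ∷ʳ x) →
              i < length xs ⊎ i ≡ length xs
∷ʳ-position xs x h = m<1+n⇒m<n∨m≡n (subst (_ <_) (length-∷ʳ xs x) h)

<-∷ʳ : ∀ {A : Set} (xs : List A) x {i} → i < length xs → i < length (xs ∷ʳ x)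
<-∷ʳ xs x h = subst (_ <_) (sym (length-∷ʳ xs x)) (m<n⇒m<1+n h)

ext-∷ʳ-old : ∀ xs x i → i < length xs → ext (xs ∷ʳ x) i ≡ ext xs i
ext-∷ʳ-old (y ∷ xs) x zero    _       = refl
ext-∷ʳ-old (y ∷ xs) x (suc i) (s≤s h) = ext-∷ʳ-old xs x i h

ext-∷ʳ-new : ∀ xs x → ext (xs ∷ʳ x) (length xs) ≡ x
ext-∷ʳ-new []       x = refl
ext-∷ʳ-new (y ∷ xs) x = ext-∷ʳ-new xs x

ext-past-end : ∀ xs i → length xs ≤ i → ext xs i ≡ 0
ext-past-end []       i       _       = refl
ext-past-end (y ∷ xs) (suc i) (s≤s h) = ext-past-end xs i h

ext-All : ∀ {P : ℕ → Set} l → (∀ i → i < length l → P (ext l i)) → All P l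
ext-All []      _ = []
ext-All (x ∷ l) H = H 0 (s≤s z≤n) ∷ ext-All l (λ i h → H (suc i) (s≤s h))

find-first : ∀ p m k j → j < k → (∀ i → i < j → p (m + i) ≡ false) →
             p (m + j) ≡ true → find p m k ≡ just (m + j)
find-first p m (suc k) zero _ _ hit with p m | trans (cong p (sym (+-identityʳ m))) hit
... | true  | _  = cong just (sym (+-identityʳ m))
... | false | ()
find-first p m (suc k) (suc j) (s≤s j<k) miss hit
  with p m | trans (cong p (sym (+-identityʳ m))) (miss 0 (s≤s z≤n))
... | true  | ()
... | false | _  = trans (find-first p (suc m) k j j<k miss′ hit′) (cong just (sym (+-suc m j)))
  where
  miss′ : ∀ i → i < j → p (suc m + i) ≡ false
  miss′ i i<j = trans (cong p (sym (+-suc m i))) (miss (suc i) (s≤s i<j))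
  hit′ : p (suc m + j) ≡ true
  hit′ = trans (cong p (sym (+-suc m j))) hit

find-miss : ∀ p m k → (∀ i → i < k → p (m + i) ≡ false) → find p m k ≡ nothing
find-miss p m zero    _    = refl
find-miss p m (suc k) miss with p m | trans (cong p (sym (+-identityʳ m))) (miss 0 (s≤s z≤n))
... | true  | ()
... | false | _  = find-miss p (suc m) k
  (λ i i<k → trans (cong p (sym (+-suc m i))) (miss (suc i) (s≤s i<k)))

find-nothing : ∀ p m k → find p m k ≡ nothing → ∀ i → i < k → p (m + i) ≡ false
find-nothing p m (suc k) none i i<k with p m in pm
find-nothing p m (suc k) ()   i       i<k       | true
find-nothing p m (suc k) none zero    _         | false = trans (cong p (+-identityʳ m)) pm
find-nothing p m (suc k) none (suc i) (s≤s i<k) | false =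
  trans (cong p (+-suc m i)) (find-nothing p (suc m) k none i i<k)

find-just : ∀ p m k j → find p m k ≡ just j → p j ≡ true × m ≤ j
find-just p m (suc k) j found with p m in pm
find-just p m (suc k) j refl  | true  = pm , ≤-refl
find-just p m (suc k) j found | false =
  let (hit , m<j) = find-just p (suc m) k j found in hit , <⇒≤ m<j

-- Rising lists

Rising : List ℕ → Set
Rising l = ∀ i → suc i < length l → ext l i < ext l (suc i)

LastBelow : List ℕ → ℕ → Set
LastBelow xs z = ∀ i → suc i ≡ length xs → ext xs i < z

rising-init : ∀ xs x → Rising (xs ∷ʳ x) → Rising xs
rising-init xs x R i h =
  subst₂ _<_ (ext-∷ʳ-old xs x i (<-trans (n<1+n i) h)) (ext-∷ʳ-old xs x (suc i) h)
    (R i (<-∷ʳ xs x h))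

rising-last : ∀ xs x → Rising (xs ∷ʳ x) → LastBelow xs x
rising-last xs x R i e =
  subst₂ _<_ (ext-∷ʳ-old xs x i (subst (i <_) e (n<1+n i)))
             (trans (cong (ext (xs ∷ʳ x)) e) (ext-∷ʳ-new xs x))
    (R i (subst (_< length (xs ∷ʳ x)) (sym e) (subst (_ <_) (sym (length-∷ʳ xs x)) (n<1+n _))))

rising-∷ʳ : ∀ xs z → Rising xs → LastBelow xs z → Rising (xs ∷ʳ z)
rising-∷ʳ xs z R L i h with ∷ʳ-position xs z h
... | inj₁ lt = subst₂ _<_ (sym (ext-∷ʳ-old xs z i (<-trans (n<1+n i) lt)))
                           (sym (ext-∷ʳ-old xs z (suc i) lt)) (R i lt)
... | inj₂ e  = subst₂ _<_ (sym (ext-∷ʳ-old xs z i (subst (i <_) e (n<1+n i))))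
                           (sym (trans (cong (ext (xs ∷ʳ z)) e) (ext-∷ʳ-new xs z))) (L i e)

rising-push : ∀ xs x → Rising (xs ∷ʳ x) → Rising (xs ∷ʳ x ∷ʳ suc x)
rising-push xs x R = rising-∷ʳ (xs ∷ʳ x) (suc x) R last<
  where
  last< : LastBelow (xs ∷ʳ x) (suc x)
  last< i e = ≤-reflexive (cong suc (trans (cong (ext (xs ∷ʳ x)) i≡) (ext-∷ʳ-new xs x)))
    where i≡ : i ≡ length xs
          i≡ = suc-injective (trans e (length-∷ʳ xs x))

rising-raise : ∀ xs x y → Rising (xs ∷ʳ x) → x ≤ y → Rising (xs ∷ʳ y)
rising-raise xs x y R x≤y =
  rising-∷ʳ xs y (rising-init xs x R) (λ i e → <-≤-trans (rising-last xs x R i e) x≤y)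

-- The oracles f₁, f₂ on rising lists

module Oracles (b : ℕ → Bool) (N : ℕ) where

  AllZero : List ℕ → Set
  AllZero l = ∀ i → i < length l → b (ext l i) ≡ false

  allZero-∷ʳ : ∀ xs x → AllZero xs → b x ≡ false → AllZero (xs ∷ʳ x)
  allZero-∷ʳ xs x Z bx i h with ∷ʳ-position xs x h
  ... | inj₁ lt   = trans (cong b (ext-∷ʳ-old xs x i lt)) (Z i lt)
  ... | inj₂ refl = trans (cong b (ext-∷ʳ-new xs x)) bx

  -- On a rising list the increase disjunct of cond₁ never fires, …
  cond₁-rising : ∀ l → Rising l → ∀ i → i < length l → cond₁ b (ext l) i ≡ b (ext l i)
  cond₁-rising l R zero    _ = refl
  cond₁-rising l R (suc i) h with ext l i <ᵇ ext l (suc i) | <⇒<ᵇ (R i h)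
  ... | true | _ = refl

  -- … until it passes the end, where the sequence drops to 0.
  cond₁-past-end : ∀ l → 0 < length l → cond₁ b (ext l) (length l) ≡ true
  cond₁-past-end l h with length l in len
  ... | suc n rewrite ext-past-end l (suc n) (≤-reflexive len) = refl

  f₁-one : ∀ l j → Rising l → j < length l → j < N →
           (∀ i → i < j → b (ext l i) ≡ false) → b (ext l j) ≡ true → f₁ b N (ext l) ≡ j
  f₁-one l j R j<l j<N Z bj = cong (fromMaybe (N ∸ 1))
    (find-first (cond₁ b (ext l)) 0 N j j<N
      (λ i i<j → trans (cond₁-rising l R i (<-trans i<j j<l)) (Z i i<j))
      (trans (cond₁-rising l R j j<l) bj))

  f₁-grow : ∀ l → Rising l → AllZero l → 0 < length l → length l < N →
            f₁ b N (ext l) ≡ length l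
  f₁-grow l R Z 0<l l<N = cong (fromMaybe (N ∸ 1))
    (find-first (cond₁ b (ext l)) 0 N (length l) l<N
      (λ i i<l → trans (cond₁-rising l R i i<l) (Z i i<l)) (cond₁-past-end l 0<l))

  f₁-full : ∀ l → Rising l → AllZero l → length l ≡ N → f₁ b N (ext l) ≡ N ∸ 1
  f₁-full l R Z l≡N = cong (fromMaybe (N ∸ 1))
    (find-miss (cond₁ b (ext l)) 0 N
      (λ i i<N → let i<l = subst (i <_) (sym l≡N) i<N in
                 trans (cond₁-rising l R i i<l) (Z i i<l)))

  reply : ℕ → ℕ
  reply m = if b m then fromMaybe (m + (N ∸ 1)) (find (λ y → not (b y)) m N)
            else m + (N ∸ 1)

  f₂-reply : ∀ α {n m} → f₁ b N α ≡ n → α n ≡ m → f₂ b N α ≡ reply m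
  f₂-reply α refl refl = refl

  reply-zero : ∀ m → b m ≡ false → reply m ≡ m + (N ∸ 1)
  reply-zero m bm rewrite bm = refl

  reply-one : ∀ m → b m ≡ true →
              reply m ≡ fromMaybe (m + (N ∸ 1)) (find (λ y → not (b y)) m N)
  reply-one m bm rewrite bm = refl

-- Unwinding the stack

vals : List (Tag × ℕ) → List ℕ
vals = map proj₂

vals-∷ʳ : ∀ ρ c x → vals (ρ ∷ʳ (c , x)) ≡ vals ρ ∷ʳ x
vals-∷ʳ ρ c x = map-++ proj₂ ρ ((c , x) ∷ [])

not-end : ∀ ρ e a o₁ o₂ → ¬ IsEnd ⟨ ρ ∷ʳ e , a ∣ o₁ , o₂ ⟩
not-end []      e a o₁ o₂ ()
not-end (_ ∷ ρ) e a o₁ o₂ ()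

module Unwinding (b : ℕ → Bool) (φ₁ φ₂ : (ℕ → ℕ) → ℕ) where
  open Algo b φ₁ φ₂

  Jump : ℕ → ℕ → Set
  Jump x y = b x ≡ true × x ≤ y × b y ≡ false

  unwind : ∀ {σ} → Reverse σ → ∀ a n y → All (λ e → ¬ Jump (proj₂ e) y) σ →
           Run ⟨ σ , a ∣ just n , just y ⟩ ⟨ [] , vals σ ++ a ∣ just n , just y ⟩
  unwind []                 a n y _     = done
  unwind (ρ ∶ r ∶ʳ (t , x)) a n y noJump =
    subst (λ a′ → Run ⟨ ρ ∷ʳ (t , x) , a ∣ just n , just y ⟩ ⟨ [] , a′ ∣ just n , just y ⟩)
      popped (pop t (proj₂ (∷ʳ⁻ noJump)))
    where
    popped : vals ρ ++ x ∷ a ≡ vals (ρ ∷ʳ (t , x)) ++ a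
    popped = trans (sym (++-assoc (vals ρ) (x ∷ []) a)) (cong (_++ a) (sym (vals-∷ʳ ρ t x)))
    rest : Run ⟨ ρ , x ∷ a ∣ just n , just y ⟩ ⟨ [] , vals ρ ++ x ∷ a ∣ just n , just y ⟩
    rest = unwind r (x ∷ a) n y (proj₁ (∷ʳ⁻ noJump))
    pop : ∀ t → ¬ Jump x y →
          Run ⟨ ρ ∷ʳ (t , x) , a ∣ just n , just y ⟩ ⟨ [] , vals ρ ++ x ∷ a ∣ just n , just y ⟩
    pop s  ¬j = step (not-end ρ _ _ _ _) (▹c₂ ρ x a n y ¬j)
                  (step (not-end ρ _ _ _ _) (▹b₂ ρ x a n y) rest)
    pop e₁ _  = step (not-end ρ _ _ _ _) (▹b₁ ρ x a n y) rest
    pop e₂ _  = step (not-end ρ _ _ _ _) (▹b₂ ρ x a n y) rest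

one≢zero : ∀ {v : Bool} → v ≡ true → ¬ v ≡ false
one≢zero refl ()

module Theorem (b : ℕ → Bool) (N : ℕ) (0<N : 0 < N) where
  open Algo b (f₁ b N) (f₂ b N)
  open Unwinding b (f₁ b N) (f₂ b N)
  open Oracles b N

  Concl : List ℕ → ℕ → Set
  Concl a n =
    (b (ext a n) ≡ true → (i : ℕ) → i < N → b (ext a n + i) ≡ b (ext a n))
    × (b (ext a n) ≡ false →
         ((i : ℕ) → suc i < N → ext a i < ext a (suc i))
         × ((i : ℕ) → i < N → b (ext a i) ≡ b (ext a 0)))

  concl-one : ∀ a n m → ext a n ≡ m → b m ≡ true → (∀ i → i < N → b (m + i) ≡ true) → Concl a n
  concl-one a n m refl bn ones =
    (λ _ i i<N → trans (ones i i<N) (sym bn)) , (λ bn0 → contradiction bn0 (one≢zero bn))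

  concl-zero : ∀ a n m → ext a n ≡ m → b m ≡ false → Rising a → AllZero a → length a ≡ N →
               Concl a n
  concl-zero a n m refl bn R Z a≡N =
    (λ bn1 → contradiction bn (one≢zero bn1)) ,
    (λ _ → (λ i i<N → R i (within i<N)) ,
           (λ i i<N → trans (Z i (within i<N)) (sym (Z 0 (within 0<N)))))
    where within : ∀ {i} → i < N → i < length a
          within = subst (_ <_) (sym a≡N)

  Goal : State → Set
  Goal st = Σ (List ℕ) λ a → Σ ℕ λ n → Σ ℕ λ y →
            Run st ⟨ [] , a ∣ just n , just y ⟩ × Concl a n

  move : ∀ {ρ e a o₁ o₂ r r′} → Move ⟨ ρ ∷ʳ e , a ∣ o₁ , o₂ ⟩ r → r ≡ r′ → Goal r′ →
         Goal ⟨ ρ ∷ʳ e , a ∣ o₁ , o₂ ⟩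
  move {ρ} m refl (a , n , y , run , concl) = a , n , y , step (not-end ρ _ _ _ _) m run , concl

  -- The state in which the oracle f₁ is about to be asked.
  Top : List (Tag × ℕ) → Tag → ℕ → State
  Top ρ c x = ⟨ ρ ∷ʳ (c , x) , [] ∣ nothing , nothing ⟩

  record Inv (ρ : List (Tag × ℕ)) (c : Tag) (x : ℕ) : Set where
    field
      rising : Rising (vals ρ ∷ʳ x)
      zeros  : AllZero (vals ρ)
      tag    : c ≡ s ⊎ (c ≡ e₁ × b x ≡ false)
  open Inv

  push-inv : ∀ ρ c x → Inv ρ c x → b x ≡ false → Inv (ρ ∷ʳ (c , x)) s (suc x)
  push-inv ρ c x I bx = record
    { rising = subst (λ l → Rising (l ∷ʳ suc x)) (sym (vals-∷ʳ ρ c x)) (rising-push (vals ρ) x (rising I))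
    ; zeros  = subst AllZero (sym (vals-∷ʳ ρ c x)) (allZero-∷ʳ (vals ρ) x (zeros I) bx)
    ; tag    = inj₁ refl }

  jump-inv : ∀ ρ x y → Inv ρ s x → Jump x y → Inv ρ e₁ y
  jump-inv ρ x y I (_ , x≤y , by) = record
    { rising = rising-raise (vals ρ) x y (rising I) x≤y
    ; zeros  = zeros I
    ; tag    = inj₂ (refl , by) }

  -- The number of entries that may still be pushed.
  Room : ℕ → List (Tag × ℕ) → Set
  Room k ρ = k + suc (length (vals ρ)) ≡ N

  room-push : ∀ k ρ c x → Room (suc k) ρ → Room k (ρ ∷ʳ (c , x))
  room-push k ρ c x room = begin
    k + suc (length (vals (ρ ∷ʳ (c , x))))  ≡⟨ cong (λ l → k + suc (length l)) (vals-∷ʳ ρ c x) ⟩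
    k + suc (length (vals ρ ∷ʳ x))          ≡⟨ cong (λ m → k + suc m) (length-∷ʳ (vals ρ) x) ⟩
    k + suc (suc (length (vals ρ)))         ≡⟨ +-suc k (suc (length (vals ρ))) ⟩
    suc k + suc (length (vals ρ))           ≡⟨ room ⟩
    N                                       ∎
    where open ≡-Reasoning

  top<N : ∀ k ρ → Room k ρ → length (vals ρ) < N
  top<N k ρ room = subst (_ <_) room (m≤n+m (suc (length (vals ρ))) k)

  ξ-∷ʳ : ∀ ρ c x → ξ (ρ ∷ʳ (c , x)) [] ≡ ext (vals ρ ∷ʳ x)
  ξ-∷ʳ ρ c x = cong ext (trans (++-identityʳ _) (vals-∷ʳ ρ c x))

  ξ-top : ∀ ρ c x → ξ (ρ ∷ʳ (c , x)) [] (length (vals ρ)) ≡ x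
  ξ-top ρ c x = trans (cong-app (ξ-∷ʳ ρ c x) _) (ext-∷ʳ-new (vals ρ) x)

  length-stack : ∀ ρ e → length (ρ ∷ʳ e) ≡ suc (length (vals ρ))
  length-stack ρ e = trans (length-∷ʳ ρ e) (cong suc (sym (length-map proj₂ ρ)))

  -- Asking f₁ from the state Top ρ c x (it lies in Q₁ by the invariant).
  ask₁ : ∀ ρ c x → Inv ρ c x → ∀ {n} → f₁ b N (ext (vals ρ ∷ʳ x)) ≡ n →
         Goal ⟨ ρ ∷ʳ (c , x) , [] ∣ just n , nothing ⟩ → Goal (Top ρ c x)
  ask₁ ρ c x I f₁≡n = move (query (tag I)) (cong (λ n → ⟨ ρ ∷ʳ (c , x) , [] ∣ just n , nothing ⟩)
                                                 (trans (cong (f₁ b N) (ξ-∷ʳ ρ c x)) f₁≡n))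
    where
    query : c ≡ s ⊎ (c ≡ e₁ × b x ≡ false) →
            Move (Top ρ c x) ⟨ ρ ∷ʳ (c , x) , [] ∣ just (f₁ b N (ξ (ρ ∷ʳ (c , x)) [])) , nothing ⟩
    query (inj₁ refl)       = q₁-s ρ x
    query (inj₂ (refl , _)) = q₁-e₁ ρ x

  ask-both : ∀ ρ c x y → Inv ρ c x → f₁ b N (ext (vals ρ ∷ʳ x)) ≡ length (vals ρ) → reply x ≡ y →
             Goal ⟨ ρ ∷ʳ (c , x) , [] ∣ just (length (vals ρ)) , just y ⟩ → Goal (Top ρ c x)
  ask-both ρ c x y I f₁≡top reply≡y goal =
    ask₁ ρ c x I f₁≡top
      (move (q₂ σ top (≤-reflexive (sym (length-stack ρ (c , x)))))
            (cong (λ y → ⟨ σ , [] ∣ just top , just y ⟩) f₂≡y) goal)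
    where
    σ = ρ ∷ʳ (c , x)
    top = length (vals ρ)
    f₂≡y : f₂ b N (ξ σ []) ≡ y
    f₂≡y = trans (f₂-reply (ξ σ []) (trans (cong (f₁ b N) (ξ-∷ʳ ρ c x)) f₁≡top) (ξ-top ρ c x)) reply≡y

  finish : ∀ ρ c x y → All (λ e → ¬ Jump (proj₂ e) y) (ρ ∷ʳ (c , x)) →
           Concl (vals ρ ∷ʳ x) (length (vals ρ)) →
           Goal ⟨ ρ ∷ʳ (c , x) , [] ∣ just (length (vals ρ)) , just y ⟩
  finish ρ c x y noJump concl =
    vals σ ++ [] , length (vals ρ) , y , unwind (reverseView σ) [] (length (vals ρ)) y noJump ,
    subst (λ a → Concl a (length (vals ρ))) (sym (trans (++-identityʳ _) (vals-∷ʳ ρ c x))) concl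
    where σ = ρ ∷ʳ (c , x)

  f₁-top-one : ∀ k ρ c x → Room k ρ → Inv ρ c x → b x ≡ true →
               f₁ b N (ext (vals ρ ∷ʳ x)) ≡ length (vals ρ)
  f₁-top-one k ρ c x room I bx =
    f₁-one (vals ρ ∷ʳ x) (length (vals ρ)) (rising I)
      (subst (_ <_) (sym (length-∷ʳ (vals ρ) x)) (n<1+n _)) (top<N k ρ room)
      (λ i i<top → trans (cong b (ext-∷ʳ-old (vals ρ) x i i<top)) (zeros I i i<top))
      (trans (cong b (ext-∷ʳ-new (vals ρ) x)) bx)

  grow : ∀ k ρ c x → Room (suc k) ρ → Inv ρ c x → b x ≡ false →
         Goal (Top (ρ ∷ʳ (c , x)) s (suc x)) → Goal (Top ρ c x)
  grow k ρ c x room I bx goal =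
    ask₁ ρ c x I f₁≡next (move (▹a ρ c x (suc top) (≤-reflexive (length-stack ρ (c , x)))) refl goal)
    where
    l = vals ρ ∷ʳ x
    top = length (vals ρ)
    l≡top+1 : length l ≡ suc top
    l≡top+1 = length-∷ʳ (vals ρ) x
    f₁≡next : f₁ b N (ext l) ≡ suc top
    f₁≡next = trans
      (f₁-grow l (rising I) (allZero-∷ʳ (vals ρ) x (zeros I) bx)
        (subst (0 <_) (sym l≡top+1) (s≤s z≤n))
        (subst (_< N) (sym l≡top+1) (subst (_ <_) room (s≤s (m≤n+m (suc top) k)))))
      l≡top+1

  -- The top x has b = 0 and the stack is full: f₁ points at the top, f₂
  -- answers x + N - 1, and no entry (all have b = 0) can jump.
  stop-zero : ∀ ρ c x → Room 0 ρ → Inv ρ c x → b x ≡ false → Goal (Top ρ c x)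
  stop-zero ρ c x room I bx =
    ask-both ρ c x y I f₁≡top (reply-zero x bx)
      (finish ρ c x y noJump (concl-zero l top x (ext-∷ʳ-new (vals ρ) x) bx (rising I) Z l≡N))
    where
    l = vals ρ ∷ʳ x
    top = length (vals ρ)
    y = x + (N ∸ 1)
    Z : AllZero l
    Z = allZero-∷ʳ (vals ρ) x (zeros I) bx
    l≡N : length l ≡ N
    l≡N = trans (length-∷ʳ (vals ρ) x) room
    f₁≡top : f₁ b N (ext l) ≡ top
    f₁≡top = trans (f₁-full l (rising I) Z l≡N) (cong (_∸ 1) (sym room))
    noJump : All (λ e → ¬ Jump (proj₂ e) y) (ρ ∷ʳ (c , x))
    noJump = All.map (λ bv (bv≡1 , _) → one≢zero bv≡1 bv)
      (map⁻ (subst (All (λ v → b v ≡ false)) (sym (vals-∷ʳ ρ c x)) (ext-All l Z)))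

  -- The top x has b = 1 and its window has no zero of b: f₂ answers
  -- x + N - 1, where b = 1, so no entry can jump.
  stop-one : ∀ k ρ x → Room k ρ → Inv ρ s x → b x ≡ true →
             find (λ y → not (b y)) x N ≡ nothing → Goal (Top ρ s x)
  stop-one k ρ x room I bx none =
    ask-both ρ s x y I (f₁-top-one k ρ s x room I bx)
      (trans (reply-one x bx) (cong (fromMaybe y) none))
      (finish ρ s x y (All.universal (λ _ (_ , _ , by) → one≢zero (ones (N ∸ 1) (pred< N 0<N)) by) _)
        (concl-one (vals ρ ∷ʳ x) (length (vals ρ)) x (ext-∷ʳ-new (vals ρ) x) bx ones))
    where
    y = x + (N ∸ 1)
    ones : ∀ i → i < N → b (x + i) ≡ true
    ones i i<N = not-injective (find-nothing (λ v → not (b v)) x N none i i<N)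
    pred< : ∀ M → 0 < M → M ∸ 1 < M
    pred< (suc M) _ = n<1+n M

  found⇒jump : ∀ {x y} → b x ≡ true → find (λ v → not (b v)) x N ≡ just y → Jump x y
  found⇒jump {x} {y} bx found =
    let (not-by , x≤y) = find-just (λ v → not (b v)) x N y found
    in bx , x≤y , not-injective not-by

  jump : ∀ k ρ x y → Room k ρ → Inv ρ s x → b x ≡ true →
         find (λ v → not (b v)) x N ≡ just y → Goal (Top ρ e₁ y) → Goal (Top ρ s x)
  jump k ρ x y room I bx found goal =
    ask-both ρ s x y I (f₁-top-one k ρ s x room I bx)
      (trans (reply-one x bx) (cong (fromMaybe (x + (N ∸ 1))) found))
      (move (▹c₁ ρ x [] (length (vals ρ)) y (found⇒jump bx found)) refl goal)

  -- The main induction on the room k: every invariant stack is driven to a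
  -- successful end state; the rounds alternate as described above.
  mutual
    from-zero : ∀ k ρ c x → Room k ρ → Inv ρ c x → b x ≡ false → Goal (Top ρ c x)
    from-zero zero    ρ c x room I bx = stop-zero ρ c x room I bx
    from-zero (suc k) ρ c x room I bx =
      grow k ρ c x room I bx
        (from-top k (ρ ∷ʳ (c , x)) s (suc x) (room-push k ρ c x room) (push-inv ρ c x I bx))

    from-top : ∀ k ρ c x → Room k ρ → Inv ρ c x → Goal (Top ρ c x)
    from-top k ρ c x room I with b x in bx
    ... | false = from-zero k ρ c x room I bx
    ... | true with tag I
    ...   | inj₂ (_ , bx≡0) = contradiction bx≡0 (one≢zero bx)
    ...   | inj₁ refl with find (λ v → not (b v)) x N in found
    ...     | nothing = stop-one k ρ x room I bx found
    ...     | just y  = jump k ρ x y room I bx found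
                          (from-zero k ρ e₁ y room (jump-inv ρ x y I (found⇒jump bx found))
                             (proj₂ (proj₂ (found⇒jump bx found))))

  run : Goal initial
  run = from-top (N ∸ 1) [] s 0 (trans (+-comm (N ∸ 1) 1) (m+[n∸m]≡n 0<N))
    record { rising = λ { i (s≤s ()) } ; zeros = λ i () ; tag = inj₁ refl }

theorem6p5 : (b : ℕ → Bool) (N : ℕ) → 0 < N →
    Σ (List ℕ) λ a → Σ ℕ λ n → Σ ℕ λ y →
      Algo.Run b (f₁ b N) (f₂ b N) initial ⟨ [] , a ∣ just n , just y ⟩
      × (b (ext a n) ≡ true → (i : ℕ) → i < N → b (ext a n + i) ≡ b (ext a n))
      × (b (ext a n) ≡ false →
           ((i : ℕ) → suc i < N → ext a i < ext a (suc i))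
           × ((i : ℕ) → i < N → b (ext a i) ≡ b (ext a 0)))
theorem6p5 b N 0<N = Theorem.run b N 0<N
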